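{- For every instance of DDP-NC with charging stations, AlgoFor-DDP-NC (described in the context) assigns each delivery to one of its $m_{max}+2$ drones, and the assignments of all these drones are feasible.
   Context: Model: $n$ deliveries with closed, pairwise disjoint delivery time intervals $I_j=[t_j^L,t_j^R]$ and costs $cost(I_j)\in(0,B]$, $B>0$ the battery capacity of identical drones. $r$ charging stations with waiting intervals $I_\ell^c=[t_\ell^A,t_\ell^D]$, $t_1^A<t_1^D<\dots<t_r^A<t_r^D$; no delivery interval is contained in a waiting interval and none intersects two waiting intervals. A drone may charge at station $\ell$ during a subinterval $[t',t'']\subseteq I_\ell^c$, its battery going from $rem$ to $Ch_\ell([t',t''],rem)\le B$ with $Ch_\ell(I_\ell^c,rem)=B$ for all $rem$; it cannot serve deliveries intersecting $[t',t'']$. Several drones may charge simultaneously. A drone starts with battery $B$; a feasible assignment is a set of delivery intervals and charging subintervals, pairwise disjoint, such that in time order each delivery's cost is at most the remaining battery when taken. A block is a set of delivery intervals of total cost at most $B$. FFD on a set $X$: sort in non-increasing cost and put each interval in the lowest-indexed block it fits into, opening a new block if none fits. AlgoFor-DDP-NC: (1) $\mathcal I_1=\{I_j: t_j^L<t_1^A\}$, $\mathcal I_\ell=\{I_j: t_{\ell-1}^A\le t_j^L<t_\ell^A\}$ ($2\le\ell\le r$), $\mathcal I_{r+1}=\{I_j:t_j^L\ge t_r^A\}$; $I_\ell^{first}$ ($\ell\ge2$) is the interval of $\mathcal I_\ell$ containing $t_{\ell-1}^D$ and $I_\ell^{last}$ ($\ell\le r$) the one containing $t_\ell^A$, if they exist.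 (2) Partition each $\mathcal I_\ell$ into $m_\ell$ blocks by FFD; $S_\ell^{first},S_\ell^{last}$ are the blocks containing $I_\ell^{first},I_\ell^{last}$. (3) $m_{max}=\max_\ell m_\ell$; open $m_{max}+2$ drones. (4) Assign blocks of $\mathcal I_1$ to distinct drones. For $\ell=2,\dots,r+1$: assign $S_\ell^{first}$ to a drone $D_\ell^{first}$ that is neither $D_{\ell-2}^{last}$ (the drone of $S_{\ell-2}^{last}$) nor assigned to a block of $\mathcal I_{\ell-1}$; assign the other blocks of $\mathcal I_\ell$ to distinct drones other than $D_{\ell-1}^{last}$ and $D_\ell^{first}$; if $\ell\le r$, every used drone with battery below $B$ other than $D_\ell^{last}$ then charges over all of $I_\ell^c$. Nonexistent objects and $D_0^{last},D_{ -1}^{last},\mathcal I_0$ are empty.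
   Formalization: The delivery and waiting times, the costs, the battery capacity B and all battery levels are rational, and each charging function $Ch_\ell$ takes rational arguments and rational values. -}

module Defs where

open import Data.Nat as ℕ using (ℕ; zero; suc; _⊔_)
open import Data.Fin as F using (Fin)
open import Data.Bool using (Bool; T; if_then_else_)
open import Data.Rational using (ℚ; 0ℚ; _+_; _-_)
open import Data.Rational as Q using ()
open import Data.Rational.Properties using (_≤?_)
open import Data.List using (List; []; _∷_; length; map; filter; foldr; upTo)
open import Data.List.Membership.Propositional using (_∈_)
open import Data.List.Relation.Unary.Unique.Propositional using (Unique)
open import Data.List.Relation.Unary.Linked using (Linked)
open import Data.List.Relation.Unary.AllPairs using (AllPairs)
open import Data.Product using (Σ; ∃; _×_; _,_; proj₁; proj₂)
open import Data.Sum using (_⊎_)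
open import Data.Unit using (⊤)
open import Relation.Nullary using (¬_; yes; no)
open import Relation.Binary.PropositionalEquality using (_≡_; _≢_)
open import Function.Bundles using (_⇔_)

-- Conventions (real numbers are replaced by rationals).  Charging stations are indexed by
-- ℕ, station k < r being the paper's station k+1 (only k < r matters).
-- Delivery groups are indexed by g ≤ r, group g being the paper's
-- 𝓘_{g+1}.

record Instance : Set where
  field
    n    : ℕ
    B    : ℚ
    tL   : Fin n → ℚ
    tR   : Fin n → ℚ
    cost : Fin n → ℚ
    r    : ℕ
    tA   : ℕ → ℚ
    tD   : ℕ → ℚ
    -- Ch k t' t'' rem : battery after charging at station k during [t',t'']
    Ch   : ℕ → ℚ → ℚ → ℚ → ℚ

module _ (I : Instance) where
  open Instance I

  Intersects : Fin n → ℕ → Set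
  Intersects j k = tL j Q.≤ tD k × tA k Q.≤ tR j

  record Valid : Set where
    field
      B-pos        : 0ℚ Q.< B
      interval     : ∀ j → tL j Q.≤ tR j
      disjoint     : ∀ j j' → j ≢ j' → tR j Q.< tL j' ⊎ tR j' Q.< tL j
      cost-pos     : ∀ j → 0ℚ Q.< cost j
      cost-le-B    : ∀ j → cost j Q.≤ B
      station-ord  : ∀ k → k ℕ.< r → tA k Q.< tD k
      station-ord' : ∀ k → suc k ℕ.< r → tD k Q.< tA (suc k)
      not-inside   : ∀ j k → k ℕ.< r → ¬ (tA k Q.≤ tL j × tR j Q.≤ tD k)
      not-two      : ∀ j k k' → k ℕ.< r → k' ℕ.< r →
                     Intersects j k → Intersects j k' → k ≡ k'
      Ch-le-B      : ∀ k t' t'' rem → k ℕ.< r → tA k Q.≤ t' → t' Q.≤ t'' →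
                     t'' Q.≤ tD k → Ch k t' t'' rem Q.≤ B
      Ch-full      : ∀ k rem → k ℕ.< r → Ch k (tA k) (tD k) rem ≡ B

  data Event : Set where
    deliver : Fin n → Event
    charge  : ℕ → ℚ → ℚ → Event     -- station k, subinterval [t',t'']

  lo : Event → ℚ
  lo (deliver j)      = tL j
  lo (charge k t' _)  = t'

  hi : Event → ℚ
  hi (deliver j)      = tR j
  hi (charge k _ t'') = t''

  WellFormed : Event → Set
  WellFormed (deliver j)       = ⊤
  WellFormed (charge k t' t'') = k ℕ.< r × tA k Q.≤ t' × t' Q.≤ t'' × t'' Q.≤ tD k

  BatteryOK : ℚ → List Event → Set
  BatteryOK rem []                         = ⊤
  BatteryOK rem (deliver j ∷ es)           = cost j Q.≤ rem × BatteryOK (rem - cost j) es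
  BatteryOK rem (charge k t' t'' ∷ es)     = BatteryOK (Ch k t' t'' rem) es

  Feasible : List Event → Set
  Feasible es = (∀ e → e ∈ es → WellFormed e)
              × AllPairs (λ e e' → hi e Q.< lo e') es
              × BatteryOK B es

  InGroup : Fin n → ℕ → Set
  InGroup j g = g ℕ.≤ r
              × (∀ {k} → g ≡ suc k → tA k Q.≤ tL j)
              × (g ℕ.< r → tL j Q.< tA g)

  IsFirst : Fin n → ℕ → Set
  IsFirst j k = InGroup j (suc k) × tL j Q.≤ tD k × tD k Q.≤ tR j

  IsLast : Fin n → ℕ → Set
  IsLast j g = g ℕ.< r × InGroup j g × tL j Q.≤ tA g × tA g Q.≤ tR j

  place : ℚ → List ℚ → ℕ × List ℚ
  place c []       = 0 , (c ∷ [])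
  place c (l ∷ ls) with (l + c) ≤? B
  ... | yes _ = 0 , ((l + c) ∷ ls)
  ... | no  _ = suc (proj₁ (place c ls)) , (l ∷ proj₂ (place c ls))

  FFD : List ℚ → List (Fin n) → (Fin n → ℕ) → ℕ → Set
  FFD loads []       blk m = length loads ≡ m
  FFD loads (j ∷ js) blk m = blk j ≡ proj₁ (place (cost j) loads)
                           × FFD (proj₂ (place (cost j) loads)) js blk m

  mmax : (ℕ → ℕ) → ℕ
  mmax m = foldr _⊔_ 0 (map m (upTo (suc r)))

  sumℚ : List ℚ → ℚ
  sumℚ = foldr _+_ 0ℚ

  module _ {M : ℕ} (ord : ℕ → List (Fin n)) (blk : Fin n → ℕ)
           (m : ℕ → ℕ) (dr : ℕ → ℕ → Fin M) (chg : ℕ → Fin M → Bool) where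

    costIn : ℕ → Fin M → ℚ
    costIn g d = sumℚ (map cost (filter (λ j → dr g (blk j) F.≟ d) (ord g)))

    -- battery of drone d right after the blocks of group g have been
    -- assigned (before the charging decisions at station g)
    battery : ℕ → Fin M → ℚ
    battery zero    d = B - costIn zero d
    battery (suc g) d = (if chg g d then Ch g (tA g) (tD g) (battery g d)
                                    else battery g d)
                        - costIn (suc g) d

    UsedUpTo : ℕ → Fin M → Set
    UsedUpTo g d = Σ ℕ λ g' → Σ ℕ λ b → g' ℕ.≤ g × b ℕ.< m g' × dr g' b ≡ d

  -- A run of AlgoFor-DDP-NC (all the choices left open are arbitrary):
  -- ord g is the FFD sorting of group g, blk j the block of j within
  -- its group, m g the number of blocks of group g, dr g b the drone of
  -- block b of group g, chg k d whether drone d charges over all of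
  -- station k's waiting interval.

  record Run : Set where
    field
      ord : ℕ → List (Fin n)
      blk : Fin n → ℕ
      m   : ℕ → ℕ
      dr  : ℕ → ℕ → Fin (mmax m ℕ.+ 2)
      chg : ℕ → Fin (mmax m ℕ.+ 2) → Bool
      ord-group  : ∀ g → g ℕ.≤ r → ∀ j → (j ∈ ord g ⇔ InGroup j g)
      ord-unique : ∀ g → g ℕ.≤ r → Unique (ord g)
      ord-sorted : ∀ g → g ℕ.≤ r → Linked (λ a b → cost b Q.≤ cost a) (ord g)
      ffd        : ∀ g → g ℕ.≤ r → FFD [] (ord g) blk (m g)
      distinct   : ∀ g b b' → g ℕ.≤ r → b ℕ.< m g → b' ℕ.< m g →
                   dr g b ≡ dr g b' → b ≡ b'
      first-prev : ∀ k j b → IsFirst j k → b ℕ.< m k →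
                   dr (suc k) (blk j) ≢ dr k b
      first-last : ∀ k k' j j' → k ≡ suc k' → IsFirst j k → IsLast j' k' →
                   dr (suc k) (blk j) ≢ dr k' (blk j')
      other-last : ∀ k b j' → b ℕ.< m (suc k) →
                   (∀ j → IsFirst j k → b ≢ blk j) →
                   IsLast j' k → dr (suc k) b ≢ dr k (blk j')
      charging   : ∀ g d →
                   (T (chg g d) ⇔
                     (g ℕ.< r × UsedUpTo ord blk m dr chg g d
                      × battery ord blk m dr chg g d Q.< B
                      × ¬ (Σ (Fin n) λ j → IsLast j g × dr g (blk j) ≡ d)))

  module _ (R : Run) where
    open Run R

    Drone : Set
    Drone = Fin (mmax m ℕ.+ 2)

    Serves : Drone → Fin n → Set
    Serves d j = Σ ℕ λ g → InGroup j g × dr g (blk j) ≡ d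

    Belongs : Drone → Event → Set
    Belongs d (deliver j)       = Serves d j
    Belongs d (charge k t' t'') = T (chg k d) × t' ≡ tA k × t'' ≡ tD k

    DroneFeasible : Drone → Set
    DroneFeasible d = Σ (List Event) λ es →
                        (∀ e → (e ∈ es ⇔ Belongs d e)) × Feasible es

{-# OPTIONS --safe #-}
module Submission where

-- Every drone d follows a schedule listing, group by group, its deliveries sorted by start time and
-- then its charge at the station ending the group. The schedule is chronological: a delivery of group
-- g reaching into waiting interval g is I^last_g, whose drone never charges at g; a delivery starting
-- inside waiting interval g is I^first_{g+1}, and D^first_{g+1} never charges at g, because it serves
-- nothing in group g and enters it full. The battery never runs out: FFD blocks cost at most B, and d
-- enters every group in which it serves full, since a drone serving in group g+1 is not D^last_g, so
-- at station g it charges to B unless the charging rule finds it unused (hence full) or full already.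
-- Finally, m_max + 2 drones always leave a drone outside the at most m_max + 1 a block must avoid.

open import Defs
open import Data.Fin using (Fin)
open import Data.Product using (Σ; _×_)
open import Relation.Binary.PropositionalEquality using (_≡_)

open import Data.Bool using (Bool; true; false; T; T?; if_then_else_)
open import Data.Empty using (⊥; ⊥-elim)
import Data.Fin as Fin
import Data.Fin.Properties as Fin
open import Data.List using (List; []; _∷_; _++_; length; map; filter; foldr; upTo; allFin; fromMaybe)
open import Data.List.Membership.Propositional using (_∈_; _∉_)
import Data.List.Membership.Propositional.Properties as ∈
import Data.List.Membership.DecPropositional as DecMembership
open import Data.List.Membership.Setoid.Properties using (index-injective)
open import Data.List.Properties using (length-++; length-map; length-upTo; filter-none; filter-accept; filter-reject)
open import Data.List.Relation.Binary.Permutation.Propositional using (_↭_; ↭-sym; ↭⇒↭ₛ)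
import Data.List.Relation.Binary.Permutation.Propositional.Properties as ↭
import Data.List.Relation.Binary.Permutation.Setoid.Properties as ↭ₛ
open import Data.List.Relation.Unary.All as All using (All; []; _∷_)
open import Data.List.Relation.Unary.AllPairs as AllPairs using (AllPairs; []; _∷_)
import Data.List.Relation.Unary.AllPairs.Properties as AllPairs
open import Data.List.Relation.Unary.Any using (here; there; index)
import Data.List.Relation.Unary.Linked.Properties as Linked
open import Data.List.Relation.Unary.Unique.Propositional using (Unique)
import Data.List.Relation.Unary.Unique.Propositional.Properties as Unique
open import Data.Maybe as Maybe using (Maybe; just; nothing)
open import Data.Maybe.Properties using (just-injective) renaming (≡-dec to Maybe-≡-dec)
open import Data.Nat as ℕ using (ℕ; zero; suc; _⊔_; z≤n; s≤s)
import Data.Nat.Properties as ℕ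
open import Data.Product using (∃; _,_; proj₁; proj₂)
open import Data.Rational using (ℚ; 0ℚ; _+_; _-_; -_; _≤_; _<_)
import Data.Rational.Properties as ℚ
open import Data.Rational.Solver using (module +-*-Solver)
open import Data.Sum using (inj₁; inj₂)
open import Data.Unit using (tt)
open import Function using (_∘_)
open import Function.Bundles using (Equivalence; mk⇔; _⇔_)
open import Relation.Binary.Definitions using (tri<; tri≈; tri>)
import Relation.Binary.Construct.Flip.EqAndOrd as Flip
import Relation.Binary.Construct.On as On
open import Relation.Binary.PropositionalEquality using (_≢_; refl; sym; trans; cong; cong₂; subst; setoid; module ≡-Reasoning)
open import Relation.Nullary using (¬_; Dec; yes; no; does)
import Relation.Nullary.Decidable as Dec
import Relation.Unary as U

p+q-p≡q : ∀ p q → p + q - p ≡ q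
p+q-p≡q = solve 2 (λ p q → p :+ q :- p := q) refl
  where open +-*-Solver

p-q-r≡p-[q+r] : ∀ p q r → p - q - r ≡ p - (q + r)
p-q-r≡p-[q+r] = solve 3 (λ p q r → p :- q :- r := p :- (q :+ r)) refl
  where open +-*-Solver

p≤p+q : ∀ p {q} → 0ℚ ≤ q → p ≤ p + q
p≤p+q p 0≤q = subst (_≤ p + _) (ℚ.+-identityʳ p) (ℚ.+-monoʳ-≤ p 0≤q)

p-q≤p : ∀ p {q} → 0ℚ ≤ q → p - q ≤ p
p-q≤p p {q} 0≤q = subst (p - q ≤_) (solve 2 (λ p q → p :- q :+ q := p) refl p q) (p≤p+q (p - q) 0≤q)
  where open +-*-Solver

sum-↭ : ∀ {xs ys : List ℚ} → xs ↭ ys → foldr _+_ 0ℚ xs ≡ foldr _+_ 0ℚ ys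
sum-↭ p = ↭ₛ.foldr-commMonoid (setoid ℚ) ℚ.+-0-isCommutativeMonoid (↭⇒↭ₛ p)

Unique-resp-↭ : ∀ {A : Set} {xs ys : List A} → xs ↭ ys → Unique xs → Unique ys
Unique-resp-↭ {A} p = ↭ₛ.Unique-resp-↭ (setoid A) (↭⇒↭ₛ p)

if-T : ∀ {A : Set} {b} {x y : A} → T b → (if b then x else y) ≡ x
if-T {b = true} _ = refl

if-¬T : ∀ {A : Set} {b} {x y : A} → ¬ T b → (if b then x else y) ≡ y
if-¬T {b = true}  ¬t = ⊥-elim (¬t tt)
if-¬T {b = false} _  = refl

filter-cong-∈ : ∀ {A : Set} {P Q : A → Set} (P? : U.Decidable P) (Q? : U.Decidable Q) xs →
                (∀ {x} → x ∈ xs → P x → Q x) → (∀ {x} → x ∈ xs → Q x → P x) →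
                filter P? xs ≡ filter Q? xs
filter-cong-∈ P? Q? []       _   _   = refl
filter-cong-∈ P? Q? (x ∷ xs) P⇒Q Q⇒P with P? x | Q? x
... | yes _  | yes _  = cong (x ∷_) (filter-cong-∈ P? Q? xs (P⇒Q ∘ there) (Q⇒P ∘ there))
... | yes px | no ¬qx = ⊥-elim (¬qx (P⇒Q (here refl) px))
... | no ¬px | yes qx = ⊥-elim (¬px (Q⇒P (here refl) qx))
... | no _   | no _   = filter-cong-∈ P? Q? xs (P⇒Q ∘ there) (Q⇒P ∘ there)

T-does⇔ : ∀ {P : Set} (P? : Dec P) → T (does P?) ⇔ P
T-does⇔ (yes p)  = mk⇔ (λ _ → p) (λ _ → tt)
T-does⇔ (no ¬p) = mk⇔ (λ ()) ¬p

module _ {A : Set} {P : A → Set} where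
  witness : Dec (∃ P) → Maybe A
  witness (yes (x , _)) = just x
  witness (no _)        = nothing

  witness-sound : ∀ P? {x} → witness P? ≡ just x → P x
  witness-sound (yes (_ , px)) refl = px

  witness-unique : (∀ {x y} → P x → P y → x ≡ y) → ∀ P? {x} → P x → witness P? ≡ just x
  witness-unique unique (yes (_ , py)) px = cong just (unique py px)
  witness-unique unique (no none)      px = ⊥-elim (none (_ , px))

∈⇒≤foldr-⊔ : ∀ {x xs} → x ∈ xs → x ℕ.≤ foldr _⊔_ 0 xs
∈⇒≤foldr-⊔ {xs = y ∷ _}  (here refl) = ℕ.m≤m⊔n y _
∈⇒≤foldr-⊔ {xs = y ∷ ys} (there x∈) = ℕ.≤-trans (∈⇒≤foldr-⊔ x∈) (ℕ.m≤n⊔m y _)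

module Fresh {M : ℕ} (default : Fin M) where
  open DecMembership (Fin._≟_ {M}) using (_∈?_)

  pick : List (Fin M) → Fin M
  pick xs with Fin.any? (λ x → Dec.¬? (x ∈? xs))
  ... | yes (x , _) = x
  ... | no _        = default

  not-all-∈ : ∀ xs → length xs ℕ.< M → ¬ (∀ x → x ∈ xs)
  not-all-∈ xs |xs|<M everywhere with Fin.pigeonhole |xs|<M (λ x → index (everywhere x))
  ... | i , j , i<j , same = Fin.<⇒≢ i<j (index-injective (setoid (Fin M)) _ _ same)

  pick-∉ : ∀ xs → length xs ℕ.< M → pick xs ∉ xs
  pick-∉ xs |xs|<M with Fin.any? (λ x → Dec.¬? (x ∈? xs))
  ... | yes (_ , x∉) = x∉
  ... | no none = ⊥-elim (not-all-∈ xs |xs|<M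
                    (λ x → Dec.decidable-stable (x ∈? xs) (λ x∉ → none (x , x∉))))

  module Assign (first : Maybe ℕ) (df : Fin M) (avoid : List (Fin M)) where
    _≟_ : (x y : Maybe ℕ) → Dec (x ≡ y)
    _≟_ = Maybe-≡-dec ℕ._≟_

    mutual
      assign : ℕ → Fin M
      assign b with first ≟ just b
      ... | yes _ = df
      ... | no  _ = pick (df ∷ avoid ++ assigned b)

      assigned : ℕ → List (Fin M)
      assigned zero    = []
      assigned (suc b) = assign b ∷ assigned b

    Fits : ℕ → Set
    Fits b = suc (length avoid ℕ.+ b) ℕ.< M

    assign-first : ∀ {b} → first ≡ just b → assign b ≡ df
    assign-first {b} first≡b with first ≟ just b
    ... | yes _     = refl
    ... | no first≢b = ⊥-elim (first≢b first≡b)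

    assign-fresh : ∀ {b} → first ≢ just b → Fits b → assign b ∉ df ∷ avoid ++ assigned b
    assign-fresh {b} first≢b fits with first ≟ just b
    ... | yes first≡b = ⊥-elim (first≢b first≡b)
    ... | no _        = pick-∉ _ (subst (ℕ._< M) (sym |list|) fits)
      where
      |assigned| : ∀ b → length (assigned b) ≡ b
      |assigned| zero    = refl
      |assigned| (suc b) = cong suc (|assigned| b)
      |list| : length (df ∷ avoid ++ assigned b) ≡ suc (length avoid ℕ.+ b)
      |list| = cong suc (trans (length-++ avoid) (cong (length avoid ℕ.+_) (|assigned| b)))

    assign-avoids : ∀ {b} → first ≢ just b → Fits b → assign b ∉ avoid
    assign-avoids first≢b fits ∈avoid = assign-fresh first≢b fits (there (∈.∈-++⁺ˡ ∈avoid))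

    assigned-∈ : ∀ {b' b} → b' ℕ.< b → assign b' ∈ assigned b
    assigned-∈ {b'} {suc b} (s≤s b'≤b) with ℕ.m≤n⇒m<n∨m≡n b'≤b
    ... | inj₁ b'<b = there (assigned-∈ b'<b)
    ... | inj₂ refl = here refl

    assign-<-injective : ∀ {b' b} → b' ℕ.< b → Fits b → assign b ≢ assign b'
    assign-<-injective {b'} {b} b'<b fits same = by-cases (first ≟ just b)
      where
      first≢b' : first ≡ just b → first ≢ just b'
      first≢b' first≡b first≡b' = ℕ.<⇒≢ b'<b (just-injective (trans (sym first≡b') first≡b))
      fits' : Fits b'
      fits' = ℕ.≤-<-trans (s≤s (ℕ.+-monoʳ-≤ (length avoid) (ℕ.<⇒≤ b'<b))) fits
      by-cases : Dec (first ≡ just b) → ⊥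
      by-cases (no first≢b)  = assign-fresh first≢b fits
        (there (∈.∈-++⁺ʳ avoid (subst (_∈ assigned b) (sym same) (assigned-∈ b'<b))))
      by-cases (yes first≡b) = assign-fresh (first≢b' first≡b) fits'
        (here (trans (sym same) (assign-first first≡b)))

    assign-injective : ∀ {b b'} → Fits b → Fits b' → assign b ≡ assign b' → b ≡ b'
    assign-injective {b} {b'} fits fits' same with ℕ.<-cmp b b'
    ... | tri< b<b' _ _ = ⊥-elim (assign-<-injective b<b' fits' (sym same))
    ... | tri≈ _ b≡b' _ = b≡b'
    ... | tri> _ _ b'<b = ⊥-elim (assign-<-injective b'<b fits same)

module _ (I : Instance) (V : Valid I) where
  open Instance I
  open Valid V

  -- Stations and delivery groups

  tD<tA : ∀ {k k'} → k ℕ.< k' → k' ℕ.< r → tD k < tA k'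
  tD<tA {k} {suc k'} (s≤s k≤k') k'+1<r with ℕ.m≤n⇒m<n∨m≡n k≤k'
  ... | inj₂ refl = station-ord' k k'+1<r
  ... | inj₁ k<k' = ℚ.<-trans (tD<tA k<k' k'<r) (ℚ.<-trans (station-ord k' k'<r) (station-ord' k' k'+1<r))
    where
    k'<r : k' ℕ.< r
    k'<r = ℕ.<-trans (ℕ.n<1+n k') k'+1<r

  tA-mono-≤ : ∀ {k k'} → k ℕ.≤ k' → k' ℕ.< r → tA k ≤ tA k'
  tA-mono-≤ k≤k' k'<r with ℕ.m≤n⇒m<n∨m≡n k≤k'
  ... | inj₂ refl = ℚ.≤-refl
  ... | inj₁ k<k' = ℚ.<⇒≤ (ℚ.<-trans (station-ord _ (ℕ.<-trans k<k' k'<r)) (tD<tA k<k' k'<r))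

  common-point⇒≡ : ∀ {j j' t} → tL j ≤ t → t ≤ tR j → tL j' ≤ t → t ≤ tR j' → j ≡ j'
  common-point⇒≡ {j} {j'} l≤t t≤r l'≤t t≤r' with j Fin.≟ j'
  ... | yes j≡j' = j≡j'
  ... | no j≢j' with disjoint j j' j≢j'
  ...   | inj₁ r<l' = ⊥-elim (ℚ.<-irrefl refl (ℚ.<-≤-trans r<l' (ℚ.≤-trans l'≤t t≤r)))
  ...   | inj₂ r'<l = ⊥-elim (ℚ.<-irrefl refl (ℚ.<-≤-trans r'<l (ℚ.≤-trans l≤t t≤r')))

  tL≤tL⇒tR<tL : ∀ {j j'} → j ≢ j' → tL j ≤ tL j' → tR j < tL j'
  tL≤tL⇒tR<tL {j} {j'} j≢j' l≤l' with disjoint j j' j≢j'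
  ... | inj₁ r<l' = r<l'
  ... | inj₂ r'<l = ⊥-elim (ℚ.<-irrefl refl (ℚ.<-≤-trans r'<l (ℚ.≤-trans l≤l' (interval j'))))

  IsFirst-unique : ∀ {j j' k} → IsFirst I j k → IsFirst I j' k → j ≡ j'
  IsFirst-unique (_ , l≤t , t≤r) (_ , l'≤t , t≤r') = common-point⇒≡ l≤t t≤r l'≤t t≤r'

  IsLast-unique : ∀ {j j' g} → IsLast I j g → IsLast I j' g → j ≡ j'
  IsLast-unique (_ , _ , l≤t , t≤r) (_ , _ , l'≤t , t≤r') = common-point⇒≡ l≤t t≤r l'≤t t≤r'

  InGroup⇒tL<tA : ∀ {j h h'} → InGroup I j h → h ℕ.≤ h' → h' ℕ.< r → tL j < tA h'
  InGroup⇒tL<tA (_ , _ , before) h≤h' h'<r = ℚ.<-≤-trans (before (ℕ.≤-<-trans h≤h' h'<r)) (tA-mono-≤ h≤h' h'<r)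

  InGroup⇒tA≤tL : ∀ {j h h'} → InGroup I j h' → h ℕ.< h' → tA h ≤ tL j
  InGroup⇒tA≤tL {h' = suc k} (k<r , after , _) (s≤s h≤k) = ℚ.≤-trans (tA-mono-≤ h≤k k<r) (after refl)

  InGroup-<-exclusive : ∀ {j g g'} → g ℕ.< g' → InGroup I j g → ¬ InGroup I j g'
  InGroup-<-exclusive {g' = suc k} (s≤s g≤k) in-g in-g'@(k<r , _) =
    ℚ.<-irrefl refl (ℚ.<-≤-trans (InGroup⇒tL<tA in-g g≤k k<r) (InGroup⇒tA≤tL in-g' ℕ.≤-refl))

  InGroup-unique : ∀ {j g g'} → InGroup I j g → InGroup I j g' → g ≡ g'
  InGroup-unique {g = g} {g'} in-g in-g' with ℕ.<-cmp g g'
  ... | tri< g<g' _ _ = ⊥-elim (InGroup-<-exclusive g<g' in-g in-g')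
  ... | tri≈ _ g≡g' _ = g≡g'
  ... | tri> _ _ g'<g = ⊥-elim (InGroup-<-exclusive g'<g in-g' in-g)

  StartsAfter : Fin n → ℕ → Set
  StartsAfter j g = ∀ {k} → g ≡ suc k → tA k ≤ tL j

  group-search : ∀ j fuel g → fuel ℕ.+ g ≡ r → StartsAfter j g → ∃ (InGroup I j)
  group-search j zero    g g≡r after = g , ℕ.≤-reflexive g≡r , after , λ g<r → ⊥-elim (ℕ.<-irrefl g≡r g<r)
  group-search j (suc fuel) g fuel+g≡r after with tL j ℚ.<? tA g
  ... | yes before = g , subst (g ℕ.≤_) fuel+g≡r (ℕ.m≤n+m g (suc fuel)) , after , λ _ → before
  ... | no ¬before = group-search j fuel (suc g) (trans (ℕ.+-suc fuel g) fuel+g≡r)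
                       λ { refl → ℚ.≮⇒≥ ¬before }

  group-exists : ∀ j → ∃ (InGroup I j)
  group-exists j = group-search j r 0 (ℕ.+-identityʳ r) λ ()

  earlier-group-before : ∀ {j j' h h'} → InGroup I j h → InGroup I j' h' → h ℕ.< h' → tR j < tL j'
  earlier-group-before {j} {j'} {h' = suc k} in-h in-h'@(k<r , _) (s≤s h≤k) =
    tL≤tL⇒tR<tL j≢j' (ℚ.<⇒≤ (ℚ.<-≤-trans (InGroup⇒tL<tA in-h h≤k k<r) (InGroup⇒tA≤tL in-h' ℕ.≤-refl)))
    where
    j≢j' : j ≢ j'
    j≢j' refl = ℕ.<-irrefl (InGroup-unique in-h in-h') (s≤s h≤k)

  ends-before-later-station : ∀ {j h h'} → InGroup I j h → h ℕ.< h' → h' ℕ.< r → tR j < tA h'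
  ends-before-later-station {j} {h} {h'} in-h h<h' h'<r with tR j ℚ.<? tA h'
  ... | yes ends-before = ends-before
  ... | no ¬ends-before = ⊥-elim (ℕ.<⇒≢ h<h' (not-two j h h' h<r h'<r meets-h meets-h'))
    where
    h<r : h ℕ.< r
    h<r = ℕ.<-trans h<h' h'<r
    tA'≤tR : tA h' ≤ tR j
    tA'≤tR = ℚ.≮⇒≥ ¬ends-before
    tL<tA' : tL j < tA h'
    tL<tA' = InGroup⇒tL<tA in-h (ℕ.<⇒≤ h<h') h'<r
    meets-h : Intersects I j h
    meets-h = ℚ.<⇒≤ (ℚ.<-trans (InGroup⇒tL<tA in-h ℕ.≤-refl h<r) (station-ord h h<r))
            , ℚ.≤-trans (tA-mono-≤ (ℕ.<⇒≤ h<h') h'<r) tA'≤tR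
    meets-h' : Intersects I j h'
    meets-h' = ℚ.<⇒≤ (ℚ.<-trans tL<tA' (station-ord h' h'<r)) , tA'≤tR

  ends-before-own-station : ∀ {j h} → InGroup I j h → h ℕ.< r → ¬ IsLast I j h → tR j < tA h
  ends-before-own-station {j} {h} in-h h<r ¬last with tR j ℚ.<? tA h
  ... | yes ends-before = ends-before
  ... | no ¬ends-before =
    ⊥-elim (¬last (h<r , in-h , ℚ.<⇒≤ (InGroup⇒tL<tA in-h ℕ.≤-refl h<r) , ℚ.≮⇒≥ ¬ends-before))

  starts-after-earlier-station : ∀ {j h h'} → InGroup I j h' → h ℕ.< h' → ¬ IsFirst I j h → tD h < tL j
  starts-after-earlier-station {j} {h} {suc k} in-h'@(k<r , _) (s≤s h≤k) ¬first with ℕ.m≤n⇒m<n∨m≡n h≤k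
  ... | inj₁ h<k = ℚ.<-≤-trans (tD<tA h<k k<r) (InGroup⇒tA≤tL in-h' ℕ.≤-refl)
  ... | inj₂ refl with tD h ℚ.<? tL j
  ...   | yes after = after
  ...   | no ¬after with tD h ℚ.≤? tR j
  ...     | yes tD≤tR = ⊥-elim (¬first (in-h' , ℚ.≮⇒≥ ¬after , tD≤tR))
  ...     | no ¬tD≤tR =
    ⊥-elim (not-inside j h k<r (InGroup⇒tA≤tL in-h' ℕ.≤-refl , ℚ.<⇒≤ (ℚ.≰⇒> ¬tD≤tR)))

  totalCost : List (Fin n) → ℚ
  totalCost xs = sumℚ I (map cost xs)

  totalCost-nonneg : ∀ xs → 0ℚ ≤ totalCost xs
  totalCost-nonneg []       = ℚ.≤-refl
  totalCost-nonneg (x ∷ xs) = ℚ.+-mono-≤ (ℚ.<⇒≤ (cost-pos x)) (totalCost-nonneg xs)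

  totalCost-↭ : ∀ {xs ys} → xs ↭ ys → totalCost xs ≡ totalCost ys
  totalCost-↭ xs↭ys = sum-↭ (↭.map⁺ cost xs↭ys)

  -- First Fit Decreasing

  load : List ℚ → ℕ → ℚ
  load []       _       = 0ℚ
  load (l ∷ _)  zero    = l
  load (_ ∷ ls) (suc b) = load ls b

  load-≤B : ∀ {ls} b → All (_≤ B) ls → load ls b ≤ B
  load-≤B b       []           = ℚ.<⇒≤ B-pos
  load-≤B zero    (l≤B ∷ _)    = l≤B
  load-≤B (suc b) (_ ∷ ls≤B)   = load-≤B b ls≤B

  chosenBlock : ℚ → List ℚ → ℕ
  chosenBlock c ls = proj₁ (place I c ls)

  loadsAfter : ℚ → List ℚ → List ℚ
  loadsAfter c ls = proj₂ (place I c ls)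

  chosenBlock-< : ∀ c ls → chosenBlock c ls ℕ.< length (loadsAfter c ls)
  chosenBlock-< c []       = s≤s z≤n
  chosenBlock-< c (l ∷ ls) with (l + c) ℚ.≤? B
  ... | yes _ = s≤s z≤n
  ... | no  _ = s≤s (chosenBlock-< c ls)

  length-loadsAfter : ∀ c ls → length ls ℕ.≤ length (loadsAfter c ls)
  length-loadsAfter c []       = z≤n
  length-loadsAfter c (l ∷ ls) with (l + c) ℚ.≤? B
  ... | yes _ = ℕ.≤-refl
  ... | no  _ = s≤s (length-loadsAfter c ls)

  load-chosenBlock : ∀ c ls → load (loadsAfter c ls) (chosenBlock c ls) ≡ load ls (chosenBlock c ls) + c
  load-chosenBlock c []       = sym (ℚ.+-identityˡ c)
  load-chosenBlock c (l ∷ ls) with (l + c) ℚ.≤? B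
  ... | yes _ = refl
  ... | no  _ = load-chosenBlock c ls

  load-otherBlock : ∀ c ls {b} → b ≢ chosenBlock c ls → load (loadsAfter c ls) b ≡ load ls b
  load-otherBlock c []       {zero}  b≢ = ⊥-elim (b≢ refl)
  load-otherBlock c []       {suc b} b≢ = refl
  load-otherBlock c (l ∷ ls) {b}     b≢ with (l + c) ℚ.≤? B
  load-otherBlock c (l ∷ ls) {zero}  b≢ | yes _ = ⊥-elim (b≢ refl)
  load-otherBlock c (l ∷ ls) {suc b} b≢ | yes _ = refl
  load-otherBlock c (l ∷ ls) {zero}  b≢ | no  _ = refl
  load-otherBlock c (l ∷ ls) {suc b} b≢ | no  _ = load-otherBlock c ls (λ b≡ → b≢ (cong suc b≡))

  loadsAfter-≤B : ∀ {c ls} → c ≤ B → All (_≤ B) ls → All (_≤ B) (loadsAfter c ls)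
  loadsAfter-≤B {c} {[]}     c≤B []           = c≤B ∷ []
  loadsAfter-≤B {c} {l ∷ ls} c≤B (l≤B ∷ ls≤B) with (l + c) ℚ.≤? B
  ... | yes l+c≤B = l+c≤B ∷ ls≤B
  ... | no  _     = l≤B ∷ loadsAfter-≤B c≤B ls≤B

  module _ {blk : Fin n → ℕ} where
    FFD-length-≤ : ∀ {ls xs m} → FFD I ls xs blk m → length ls ℕ.≤ m
    FFD-length-≤ {xs = []}     |ls|≡m       = ℕ.≤-reflexive |ls|≡m
    FFD-length-≤ {ls} {x ∷ xs} (_ , ffd) = ℕ.≤-trans (length-loadsAfter (cost x) ls) (FFD-length-≤ ffd)

    FFD-block-< : ∀ {ls xs m j} → FFD I ls xs blk m → j ∈ xs → blk j ℕ.< m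
    FFD-block-< {ls} {x ∷ _} (blk-x , ffd) (here refl) =
      subst (ℕ._< _) (sym blk-x) (ℕ.<-≤-trans (chosenBlock-< (cost x) ls) (FFD-length-≤ ffd))
    FFD-block-< (_ , ffd) (there j∈xs) = FFD-block-< ffd j∈xs

    inBlock : ℕ → List (Fin n) → List (Fin n)
    inBlock b = filter (λ j → blk j ℕ.≟ b)

    FFD-load-≤B : ∀ {ls xs m} → FFD I ls xs blk m → All (_≤ B) ls → ∀ b →
                  load ls b + totalCost (inBlock b xs) ≤ B
    FFD-load-≤B {ls} {[]} _ ls≤B b = subst (_≤ B) (sym (ℚ.+-identityʳ _)) (load-≤B b ls≤B)
    FFD-load-≤B {ls} {x ∷ xs} (blk-x , ffd) ls≤B b with blk x ℕ.≟ b
    ... | yes blk-x≡b = subst (_≤ B) shift (FFD-load-≤B ffd (loadsAfter-≤B (cost-le-B x) ls≤B) b)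
      where
      open ≡-Reasoning
      rest : ℚ
      rest = totalCost (inBlock b xs)
      shift : load (loadsAfter (cost x) ls) b + rest ≡ load ls b + totalCost (inBlock b (x ∷ xs))
      shift = begin
        load (loadsAfter (cost x) ls) b + rest
          ≡⟨ cong (λ b → load (loadsAfter (cost x) ls) b + rest) (trans (sym blk-x≡b) blk-x) ⟩
        load (loadsAfter (cost x) ls) (chosenBlock (cost x) ls) + rest
          ≡⟨ cong (_+ rest) (load-chosenBlock (cost x) ls) ⟩
        load ls (chosenBlock (cost x) ls) + cost x + rest
          ≡⟨ cong (λ b → load ls b + cost x + rest) (trans (sym blk-x) blk-x≡b) ⟩
        load ls b + cost x + rest
          ≡⟨ ℚ.+-assoc (load ls b) (cost x) rest ⟩
        load ls b + (cost x + rest)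
          ≡⟨ cong (λ ys → load ls b + totalCost ys) (sym (filter-accept (λ j → blk j ℕ.≟ b) blk-x≡b)) ⟩
        load ls b + totalCost (inBlock b (x ∷ xs)) ∎
    ... | no blk-x≢b = subst (_≤ B) shift (FFD-load-≤B ffd (loadsAfter-≤B (cost-le-B x) ls≤B) b)
      where
      shift : load (loadsAfter (cost x) ls) b + totalCost (inBlock b xs) ≡ load ls b + totalCost (inBlock b (x ∷ xs))
      shift = cong₂ (λ l ys → l + totalCost ys)
        (load-otherBlock (cost x) ls (λ b≡ → blk-x≢b (trans blk-x (sym b≡))))
        (sym (filter-reject (λ j → blk j ℕ.≟ b) blk-x≢b))

  firstFitLoads : List ℚ → List (Fin n) → List ℚ
  firstFitLoads ls []       = ls
  firstFitLoads ls (x ∷ xs) = firstFitLoads (loadsAfter (cost x) ls) xs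

  firstFitBlock : List ℚ → List (Fin n) → Fin n → ℕ
  firstFitBlock ls []       j = 0
  firstFitBlock ls (x ∷ xs) j with j Fin.≟ x
  ... | yes _ = chosenBlock (cost x) ls
  ... | no  _ = firstFitBlock (loadsAfter (cost x) ls) xs j

  FFD-firstFit : ∀ (blk : Fin n → ℕ) ls xs → Unique xs → (∀ {j} → j ∈ xs → blk j ≡ firstFitBlock ls xs j) →
                 FFD I ls xs blk (length (firstFitLoads ls xs))
  FFD-firstFit blk ls []       _               _       = refl
  FFD-firstFit blk ls (x ∷ xs) (x∉xs ∷ unique) agrees =
    trans (agrees (here refl)) at-x , FFD-firstFit blk _ xs unique λ j∈ → trans (agrees (there j∈)) (past-x j∈)
    where
    at-x : firstFitBlock ls (x ∷ xs) x ≡ chosenBlock (cost x) ls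
    at-x with x Fin.≟ x
    ... | yes _   = refl
    ... | no x≢x = ⊥-elim (x≢x refl)
    past-x : ∀ {j} → j ∈ xs → firstFitBlock ls (x ∷ xs) j ≡ firstFitBlock (loadsAfter (cost x) ls) xs j
    past-x {j} j∈ with j Fin.≟ x
    ... | yes refl = ⊥-elim (All.lookup x∉xs j∈ refl)
    ... | no  _    = refl

  -- Battery along a list of events

  remaining : ℚ → List (Event I) → ℚ
  remaining rem []                       = rem
  remaining rem (deliver j ∷ es)         = remaining (rem - cost j) es
  remaining rem (charge k t' t'' ∷ es)   = remaining (Ch k t' t'' rem) es

  remaining-++ : ∀ rem xs {ys} → remaining rem (xs ++ ys) ≡ remaining (remaining rem xs) ys
  remaining-++ rem []                    = refl
  remaining-++ rem (deliver j ∷ xs)      = remaining-++ (rem - cost j) xs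
  remaining-++ rem (charge k t' t'' ∷ xs) = remaining-++ (Ch k t' t'' rem) xs

  BatteryOK-++ : ∀ rem xs {ys} → BatteryOK I rem xs → BatteryOK I (remaining rem xs) ys →
                 BatteryOK I rem (xs ++ ys)
  BatteryOK-++ rem []                     _              ok-ys = ok-ys
  BatteryOK-++ rem (deliver j ∷ xs)       (c≤rem , ok-xs) ok-ys = c≤rem , BatteryOK-++ (rem - cost j) xs ok-xs ok-ys
  BatteryOK-++ rem (charge k t' t'' ∷ xs) ok-xs          ok-ys = BatteryOK-++ (Ch k t' t'' rem) xs ok-xs ok-ys

  remaining-deliveries : ∀ rem xs → remaining rem (map deliver xs) ≡ rem - totalCost xs
  remaining-deliveries rem []       = sym (ℚ.+-identityʳ rem)
  remaining-deliveries rem (x ∷ xs) =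
    trans (remaining-deliveries (rem - cost x) xs) (p-q-r≡p-[q+r] rem (cost x) (totalCost xs))

  BatteryOK-deliveries-≤ : ∀ {rem} xs → totalCost xs ≤ rem → BatteryOK I rem (map deliver xs)
  BatteryOK-deliveries-≤ []       _ = tt
  BatteryOK-deliveries-≤ {rem} (x ∷ xs) total≤rem =
      ℚ.≤-trans (p≤p+q (cost x) (totalCost-nonneg xs)) total≤rem
    , BatteryOK-deliveries-≤ xs (subst (_≤ rem - cost x) (p+q-p≡q (cost x) (totalCost xs))
                                   (ℚ.+-monoˡ-≤ (- cost x) total≤rem))

  BatteryOK-deliveries : ∀ {rem} xs → totalCost xs ≤ B → (∀ {x} → x ∈ xs → rem ≡ B) →
                         BatteryOK I rem (map deliver xs)
  BatteryOK-deliveries []       _         _        = tt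
  BatteryOK-deliveries (x ∷ xs) total≤B full =
    BatteryOK-deliveries-≤ (x ∷ xs) (subst (_ ≤_) (sym (full (here refl))) total≤B)

  open import Data.List.Sort (On.decTotalOrder ℚ.≤-decTotalOrder tL)
    using () renaming (sort to sortByStart; sort-↭ to sortByStart-↭; sort-↗ to sortByStart-↗)

  sortByStart-chronological : ∀ {xs} → Unique xs → AllPairs (λ j j' → tR j < tL j') (sortByStart xs)
  sortByStart-chronological {xs} unique = AllPairs.zipWith (λ (tL≤tL' , j≢j') → tL≤tL⇒tR<tL j≢j' tL≤tL')
    ( Linked.Linked⇒AllPairs ℚ.≤-trans (sortByStart-↗ xs)
    , Unique-resp-↭ (↭-sym (sortByStart-↭ xs)) unique)

  -- Feasibility of every run

  module Feasibility (R : Run I) where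
    open Run R

    ∈ord⇒InGroup : ∀ {g j} → g ℕ.≤ r → j ∈ ord g → InGroup I j g
    ∈ord⇒InGroup g≤r = Equivalence.to (ord-group _ g≤r _)

    InGroup⇒∈ord : ∀ {g j} → InGroup I j g → j ∈ ord g
    InGroup⇒∈ord in-g@(g≤r , _) = Equivalence.from (ord-group _ g≤r _) in-g

    InGroup⇒block-< : ∀ {g j} → InGroup I j g → blk j ℕ.< m g
    InGroup⇒block-< in-g@(g≤r , _) = FFD-block-< (ffd _ g≤r) (InGroup⇒∈ord in-g)

    served-by-unique-drone : ∀ j → Σ (Drone I R) λ d → Serves I R d j × (∀ d' → Serves I R d' j → d' ≡ d)
    served-by-unique-drone j with group-exists j
    ... | g , in-g = dr g (blk j) , (g , in-g , refl) , λ { d' (g' , in-g' , serves) →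
                       trans (sym serves) (cong (λ h → dr h (blk j)) (InGroup-unique in-g' in-g)) }

    module ForDrone (d : Drone I R) where
      deliveries : ℕ → List (Fin n)
      deliveries g = filter (λ j → dr g (blk j) Fin.≟ d) (ord g)

      ∈deliveries⁻ : ∀ {g j} → j ∈ deliveries g → j ∈ ord g × dr g (blk j) ≡ d
      ∈deliveries⁻ = ∈.∈-filter⁻ (λ j → dr _ (blk j) Fin.≟ d)

      ∈deliveries⁺ : ∀ {g j} → j ∈ ord g → dr g (blk j) ≡ d → j ∈ deliveries g
      ∈deliveries⁺ = ∈.∈-filter⁺ (λ j → dr _ (blk j) Fin.≟ d)

      Used : ℕ → Set
      Used g = UsedUpTo I ord blk m dr chg g d

      IsLastDrone : ℕ → Set
      IsLastDrone g = Σ (Fin n) λ j → IsLast I j g × dr g (blk j) ≡ d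

      level : ℕ → ℚ
      level g = battery I ord blk m dr chg g d

      recharged : ℕ → ℚ
      recharged g = if chg g d then Ch g (tA g) (tD g) (level g) else level g

      entering : ℕ → ℚ
      entering zero    = B
      entering (suc g) = recharged g

      level≡entering-totalCost : ∀ g → level g ≡ entering g - totalCost (deliveries g)
      level≡entering-totalCost zero    = refl
      level≡entering-totalCost (suc g) = refl

      charges⇒ : ∀ {g} → T (chg g d) → g ℕ.< r × Used g × level g < B × ¬ IsLastDrone g
      charges⇒ = Equivalence.to (charging _ d)

      charges⇐ : ∀ {g} → g ℕ.< r → Used g → level g < B → ¬ IsLastDrone g → T (chg g d)
      charges⇐ g<r used low notLast = Equivalence.from (charging _ d) (g<r , used , low , notLast)

      recharged-charging : ∀ {g} → T (chg g d) → recharged g ≡ B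
      recharged-charging {g} charges = trans (if-T charges) (Ch-full g (level g) (proj₁ (charges⇒ charges)))

      recharged-idle : ∀ {g} → ¬ T (chg g d) → recharged g ≡ level g
      recharged-idle = if-¬T

      mutual
        recharged-≤B : ∀ g → recharged g ≤ B
        recharged-≤B g with T? (chg g d)
        ... | yes charges    = ℚ.≤-reflexive (recharged-charging charges)
        ... | no  no-charge = subst (_≤ B) (sym (recharged-idle no-charge)) (level-≤B g)

        level-≤B : ∀ g → level g ≤ B
        level-≤B g = subst (_≤ B) (sym (level≡entering-totalCost g))
          (ℚ.≤-trans (p-q≤p (entering g) (totalCost-nonneg (deliveries g))) (entering-≤B g))

        entering-≤B : ∀ g → entering g ≤ B
        entering-≤B zero    = ℚ.≤-refl
        entering-≤B (suc g) = recharged-≤B g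

      idle⇒level≡entering : ∀ {g} → deliveries g ≡ [] → level g ≡ entering g
      idle⇒level≡entering {g} none = trans (level≡entering-totalCost g)
        (trans (cong (λ js → entering g - totalCost js) none) (ℚ.+-identityʳ (entering g)))

      Used-suc : ∀ {g} → Used g → Used (suc g)
      Used-suc (g' , b , g'≤g , b<m , dr≡d) = g' , b , ℕ.m≤n⇒m≤1+n g'≤g , b<m , dr≡d

      serving⇒Used : ∀ {g j} → g ℕ.≤ r → j ∈ deliveries g → Used g
      serving⇒Used g≤r j∈ with ∈deliveries⁻ j∈
      ... | j∈ord , dr≡d = _ , _ , ℕ.≤-refl , InGroup⇒block-< (∈ord⇒InGroup g≤r j∈ord) , dr≡d

      idle : ∀ {g} → (∀ {j} → j ∈ ord g → dr g (blk j) ≢ d) → deliveries g ≡ []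
      idle {g} none = filter-none (λ j → dr g (blk j) Fin.≟ d) (All.tabulate none)

      unused⇒idle : ∀ {g} → g ℕ.≤ r → ¬ Used g → deliveries g ≡ []
      unused⇒idle g≤r unused = idle λ j∈ord dr≡d → unused (serving⇒Used g≤r (∈deliveries⁺ j∈ord dr≡d))

      unused⇒full : ∀ g → g ℕ.≤ r → ¬ Used g → level g ≡ B
      unused⇒full zero    g≤r unused = idle⇒level≡entering (unused⇒idle g≤r unused)
      unused⇒full (suc g) g≤r unused = trans (idle⇒level≡entering (unused⇒idle g≤r unused))
        (trans (recharged-idle no-charge) (unused⇒full g (ℕ.≤-trans (ℕ.n≤1+n g) g≤r) (unused ∘ Used-suc)))
        where
        no-charge : ¬ T (chg g d)
        no-charge charges = unused (Used-suc (proj₁ (proj₂ (charges⇒ charges))))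

      -- Not charging means the charging rule fails, and a drone other than D^last_g that is used
      -- and below B would satisfy it.
      recharged≡B : ∀ {g} → g ℕ.< r → ¬ IsLastDrone g → recharged g ≡ B
      recharged≡B {g} g<r notLast with T? (chg g d)
      ... | yes charges   = recharged-charging charges
      ... | no  no-charge = trans (recharged-idle no-charge) level≡B
        where
        level≡B : level g ≡ B
        level≡B with level g ℚ.<? B
        ... | no  ¬low = ℚ.≤-antisym (level-≤B g) (ℚ.≮⇒≥ ¬low)
        ... | yes low  = ⊥-elim (ℚ.<-irrefl (unused⇒full g (ℕ.<⇒≤ g<r) unused) low)
          where
          unused : ¬ Used g
          unused used = no-charge (charges⇐ g<r used low notLast)

      -- D^first_{h+1} avoids every drone of group h and the other blocks avoid D^last_h.
      serving-next⇒¬IsLastDrone : ∀ {h x} → suc h ℕ.≤ r → x ∈ deliveries (suc h) → ¬ IsLastDrone h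
      serving-next⇒¬IsLastDrone {h} {x} h<r x∈ (j' , last , dr≡d) =
        other-last h (blk x) j' (InGroup⇒block-< in-group) not-first last (trans serves (sym dr≡d))
        where
        in-group : InGroup I x (suc h)
        in-group = ∈ord⇒InGroup h<r (proj₁ (∈deliveries⁻ x∈))
        serves : dr (suc h) (blk x) ≡ d
        serves = proj₂ (∈deliveries⁻ x∈)
        not-first : ∀ j → IsFirst I j h → blk x ≢ blk j
        not-first j first same-block = first-prev h j (blk j') first (InGroup⇒block-< (proj₁ (proj₂ last)))
          (trans (cong (dr (suc h)) (sym same-block)) (trans serves (sym dr≡d)))

      entering≡B : ∀ {g x} → g ℕ.≤ r → x ∈ deliveries g → entering g ≡ B
      entering≡B {zero}  _   _  = refl
      entering≡B {suc h} h<r x∈ = recharged≡B h<r (serving-next⇒¬IsLastDrone h<r x∈)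

      first-drone-enters-full : ∀ {h j} → IsFirst I j h → dr (suc h) (blk j) ≡ d → entering h ≡ B
      first-drone-enters-full {zero}   _                   _    = refl
      first-drone-enters-full {suc h₀} {j} first@(in-group , _) dr≡d =
        recharged≡B (ℕ.<⇒≤ (proj₁ in-group)) λ (j' , last , dr'≡d) →
          first-last (suc h₀) h₀ j j' refl first last (trans dr≡d (sym dr'≡d))

      first-drone-skips-charging : ∀ {h j} → IsFirst I j h → dr (suc h) (blk j) ≡ d → ¬ T (chg h d)
      first-drone-skips-charging {h} {j} first dr≡d charges with charges⇒ charges
      ... | h<r , _ , low , _ =
        ℚ.<-irrefl (trans (idle⇒level≡entering (idle no-block)) (first-drone-enters-full first dr≡d)) low
        where
        no-block : ∀ {j'} → j' ∈ ord h → dr h (blk j') ≢ d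
        no-block {j'} j'∈ord dr'≡d = first-prev h j (blk j') first
          (InGroup⇒block-< (∈ord⇒InGroup (ℕ.<⇒≤ h<r) j'∈ord)) (trans dr≡d (sym dr'≡d))

      chargeEvents : ℕ → List (Event I)
      chargeEvents g = if chg g d then charge g (tA g) (tD g) ∷ [] else []

      groupEvents : ℕ → List (Event I)
      groupEvents g = map deliver (sortByStart (deliveries g)) ++ chargeEvents g

      schedule : ℕ → List (Event I)
      schedule zero    = groupEvents zero
      schedule (suc g) = schedule g ++ groupEvents (suc g)

      GroupEvent : ℕ → Event I → Set
      GroupEvent g (deliver j)       = j ∈ deliveries g
      GroupEvent g (charge k t' t'') = T (chg g d) × k ≡ g × t' ≡ tA g × t'' ≡ tD g

      ∈chargeEvents⁻ : ∀ {g e} → e ∈ chargeEvents g → T (chg g d) × e ≡ charge g (tA g) (tD g)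
      ∈chargeEvents⁻ {g} e∈ with chg g d
      ∈chargeEvents⁻ (here refl) | true = tt , refl

      ∈chargeEvents⁺ : ∀ {g} → T (chg g d) → charge g (tA g) (tD g) ∈ chargeEvents g
      ∈chargeEvents⁺ {g} charges with chg g d
      ... | true = here refl

      ∈groupEvents⁻ : ∀ {g e} → e ∈ groupEvents g → GroupEvent g e
      ∈groupEvents⁻ {g} e∈ with ∈.∈-++⁻ (map deliver (sortByStart (deliveries g))) e∈
      ... | inj₁ e∈deliver with ∈.∈-map⁻ deliver e∈deliver
      ...   | j , j∈ , refl = ↭.∈-resp-↭ (sortByStart-↭ (deliveries g)) j∈
      ∈groupEvents⁻ {g} e∈ | inj₂ e∈charge with ∈chargeEvents⁻ e∈charge
      ...   | charges , refl = charges , refl , refl , refl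

      ∈groupEvents⁺ : ∀ {g e} → GroupEvent g e → e ∈ groupEvents g
      ∈groupEvents⁺ {g} {deliver j} j∈ =
        ∈.∈-++⁺ˡ (∈.∈-map⁺ deliver (↭.∈-resp-↭ (↭-sym (sortByStart-↭ (deliveries g))) j∈))
      ∈groupEvents⁺ {g} {charge k t' t''} (charges , refl , refl , refl) =
        ∈.∈-++⁺ʳ (map deliver (sortByStart (deliveries g))) (∈chargeEvents⁺ charges)

      ∈schedule⁻ : ∀ {g e} → e ∈ schedule g → ∃ λ h → h ℕ.≤ g × GroupEvent h e
      ∈schedule⁻ {zero} e∈ = zero , z≤n , ∈groupEvents⁻ e∈
      ∈schedule⁻ {suc g} e∈ with ∈.∈-++⁻ (schedule g) e∈
      ... | inj₁ e∈earlier with ∈schedule⁻ e∈earlier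
      ...   | h , h≤g , in-h = h , ℕ.m≤n⇒m≤1+n h≤g , in-h
      ∈schedule⁻ {suc g} e∈ | inj₂ e∈last = suc g , ℕ.≤-refl , ∈groupEvents⁻ e∈last

      ∈schedule⁺ : ∀ {h g e} → h ℕ.≤ g → GroupEvent h e → e ∈ schedule g
      ∈schedule⁺ {g = zero}  z≤n in-h = ∈groupEvents⁺ in-h
      ∈schedule⁺ {h} {suc g} h≤g in-h with ℕ.m≤n⇒m<n∨m≡n h≤g
      ... | inj₁ (s≤s h≤g') = ∈.∈-++⁺ˡ (∈schedule⁺ h≤g' in-h)
      ... | inj₂ refl       = ∈.∈-++⁺ʳ (schedule g) (∈groupEvents⁺ in-h)

      GroupEvent⇒Belongs : ∀ {h e} → h ℕ.≤ r → GroupEvent h e → Belongs I R d e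
      GroupEvent⇒Belongs {h} {deliver j} h≤r j∈ with ∈deliveries⁻ j∈
      ... | j∈ord , dr≡d = h , ∈ord⇒InGroup h≤r j∈ord , dr≡d
      GroupEvent⇒Belongs {h} {charge k t' t''} _ (charges , refl , refl , refl) = charges , refl , refl

      Belongs⇒GroupEvent : ∀ {e} → Belongs I R d e → ∃ λ h → h ℕ.≤ r × GroupEvent h e
      Belongs⇒GroupEvent {deliver j} (g , in-g@(g≤r , _) , dr≡d) =
        g , g≤r , ∈deliveries⁺ (InGroup⇒∈ord in-g) dr≡d
      Belongs⇒GroupEvent {charge k t' t''} (charges , refl , refl) =
        k , ℕ.<⇒≤ (proj₁ (charges⇒ charges)) , charges , refl , refl , refl

      GroupEvent⇒WellFormed : ∀ {h e} → GroupEvent h e → WellFormed I e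
      GroupEvent⇒WellFormed {h} {deliver j} _ = tt
      GroupEvent⇒WellFormed {h} {charge k t' t''} (charges , refl , refl , refl) =
        h<r , ℚ.≤-refl , ℚ.<⇒≤ (station-ord h h<r) , ℚ.≤-refl
        where
        h<r : h ℕ.< r
        h<r = proj₁ (charges⇒ charges)

      Before : Event I → Event I → Set
      Before e e' = hi I e < lo I e'

      delivery-before-own-charge : ∀ {g j} → j ∈ deliveries g → T (chg g d) → tR j < tA g
      delivery-before-own-charge {g} {j} j∈ charges with charges⇒ charges | ∈deliveries⁻ j∈
      ... | g<r , _ , _ , notLast | j∈ord , dr≡d =
        ends-before-own-station (∈ord⇒InGroup (ℕ.<⇒≤ g<r) j∈ord) g<r λ last → notLast (j , last , dr≡d)

      groupEvents-ordered : ∀ {h h' e e'} → h ℕ.< h' → h' ℕ.≤ r →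
                            GroupEvent h e → GroupEvent h' e' → Before e e'
      groupEvents-ordered {h} {h'} {deliver j} {deliver j'} h<h' h'≤r j∈ j'∈ =
        earlier-group-before (∈ord⇒InGroup (ℕ.≤-trans (ℕ.<⇒≤ h<h') h'≤r) (proj₁ (∈deliveries⁻ j∈)))
                             (∈ord⇒InGroup h'≤r (proj₁ (∈deliveries⁻ j'∈))) h<h'
      groupEvents-ordered {h} {h'} {deliver j} {charge _ _ _} h<h' _ j∈ (charges' , refl , refl , refl) =
        ends-before-later-station (∈ord⇒InGroup (ℕ.<⇒≤ h<r) (proj₁ (∈deliveries⁻ j∈))) h<h' h'<r
        where
        h'<r : h' ℕ.< r
        h'<r = proj₁ (charges⇒ charges')
        h<r : h ℕ.< r
        h<r = ℕ.<-trans h<h' h'<r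
      groupEvents-ordered {h} {h'} {charge _ _ _} {deliver j'} h<h' h'≤r (charges , refl , refl , refl) j'∈ =
        starts-after-earlier-station in-h' h<h' not-first
        where
        in-h' : InGroup I j' h'
        in-h' = ∈ord⇒InGroup h'≤r (proj₁ (∈deliveries⁻ j'∈))
        not-first : ¬ IsFirst I j' h
        not-first first@(in-suc-h , _) = first-drone-skips-charging first
          (subst (λ g → dr g (blk j') ≡ d) (InGroup-unique in-h' in-suc-h) (proj₂ (∈deliveries⁻ j'∈))) charges
      groupEvents-ordered {e = charge _ _ _} {charge _ _ _} h<h' _ (_ , refl , refl , refl) (charges' , refl , refl , refl) =
        tD<tA h<h' (proj₁ (charges⇒ charges'))

      chargeEvents-AllPairs : ∀ {R : Event I → Event I → Set} g → AllPairs R (chargeEvents g)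
      chargeEvents-AllPairs g with chg g d
      ... | true  = [] ∷ []
      ... | false = []

      groupEvents-chronological : ∀ {g} → g ℕ.≤ r → AllPairs Before (groupEvents g)
      groupEvents-chronological {g} g≤r = AllPairs.++⁺
        (AllPairs.map⁺ (sortByStart-chronological (Unique.filter⁺ _ (ord-unique g g≤r))))
        (chargeEvents-AllPairs g)
        (All.tabulate λ e∈ → All.tabulate λ e'∈ → deliveries-first e∈ e'∈)
        where
        deliveries-first : ∀ {e e'} → e ∈ map deliver (sortByStart (deliveries g)) → e' ∈ chargeEvents g → Before e e'
        deliveries-first e∈ e'∈ with ∈.∈-map⁻ deliver e∈ | ∈chargeEvents⁻ e'∈
        ... | j , j∈ , refl | charges , refl =
          delivery-before-own-charge (↭.∈-resp-↭ (sortByStart-↭ (deliveries g)) j∈) charges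

      schedule-chronological : ∀ g → g ℕ.≤ r → AllPairs Before (schedule g)
      schedule-chronological zero    g≤r = groupEvents-chronological g≤r
      schedule-chronological (suc g) g≤r = AllPairs.++⁺
        (schedule-chronological g (ℕ.<⇒≤ g≤r)) (groupEvents-chronological g≤r)
        (All.tabulate λ e∈ → All.tabulate λ e'∈ → earlier e∈ e'∈)
        where
        earlier : ∀ {e e'} → e ∈ schedule g → e' ∈ groupEvents (suc g) → Before e e'
        earlier e∈ e'∈ with ∈schedule⁻ e∈
        ... | h , h≤g , in-h = groupEvents-ordered (s≤s h≤g) g≤r in-h (∈groupEvents⁻ e'∈)

      deliveries-total-≤B : ∀ {g} → g ℕ.≤ r → totalCost (deliveries g) ≤ B
      deliveries-total-≤B {g} g≤r with deliveries g in served
      ... | []    = ℚ.<⇒≤ B-pos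
      ... | x ∷ _ = subst (_≤ B) (trans (ℚ.+-identityˡ _) (cong totalCost (trans (sym one-block) served)))
                      (FFD-load-≤B (ffd g g≤r) [] (blk x))
        where
        x-served : x ∈ ord g × dr g (blk x) ≡ d
        x-served = ∈deliveries⁻ (subst (x ∈_) (sym served) (here refl))
        block-< : ∀ {j} → j ∈ ord g → blk j ℕ.< m g
        block-< j∈ord = InGroup⇒block-< (∈ord⇒InGroup g≤r j∈ord)
        one-block : deliveries g ≡ inBlock (blk x) (ord g)
        one-block = filter-cong-∈ _ _ (ord g)
          (λ j∈ord dr≡d → distinct g _ _ g≤r (block-< j∈ord) (block-< (proj₁ x-served))
                                            (trans dr≡d (sym (proj₂ x-served))))
          (λ _ same-block → trans (cong (dr g) same-block) (proj₂ x-served))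

      chargeEvents-battery : ∀ g rem → BatteryOK I rem (chargeEvents g)
                             × remaining rem (chargeEvents g) ≡ (if chg g d then Ch g (tA g) (tD g) rem else rem)
      chargeEvents-battery g rem with chg g d
      ... | true  = tt , refl
      ... | false = tt , refl

      groupEvents-battery : ∀ {g} → g ℕ.≤ r → BatteryOK I (entering g) (groupEvents g)
                            × remaining (entering g) (groupEvents g) ≡ recharged g
      groupEvents-battery {g} g≤r =
          BatteryOK-++ (entering g) (map deliver sorted) deliveries-ok
            (subst (λ x → BatteryOK I x (chargeEvents g)) (sym after-deliveries) (proj₁ (chargeEvents-battery g (level g))))
        , trans (remaining-++ (entering g) (map deliver sorted))
            (trans (cong (λ x → remaining x (chargeEvents g)) after-deliveries) (proj₂ (chargeEvents-battery g (level g))))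
        where
        sorted : List (Fin n)
        sorted = sortByStart (deliveries g)
        deliveries-ok : BatteryOK I (entering g) (map deliver sorted)
        deliveries-ok = BatteryOK-deliveries sorted
          (subst (_≤ B) (sym (totalCost-↭ (sortByStart-↭ (deliveries g)))) (deliveries-total-≤B g≤r))
          (λ x∈ → entering≡B g≤r (↭.∈-resp-↭ (sortByStart-↭ (deliveries g)) x∈))
        after-deliveries : remaining (entering g) (map deliver sorted) ≡ level g
        after-deliveries = trans (remaining-deliveries (entering g) sorted)
          (trans (cong (λ c → entering g - c) (totalCost-↭ (sortByStart-↭ (deliveries g))))
                 (sym (level≡entering-totalCost g)))

      schedule-battery : ∀ g → g ℕ.≤ r → BatteryOK I B (schedule g) × remaining B (schedule g) ≡ recharged g
      schedule-battery zero    g≤r = groupEvents-battery g≤r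
      schedule-battery (suc g) g≤r with schedule-battery g (ℕ.<⇒≤ g≤r) | groupEvents-battery g≤r
      ... | ok , after | ok' , after' =
          BatteryOK-++ B (schedule g) ok (subst (λ x → BatteryOK I x (groupEvents (suc g))) (sym after) ok')
        , trans (remaining-++ B (schedule g)) (trans (cong (λ x → remaining x (groupEvents (suc g))) after) after')

      feasible : DroneFeasible I R d
      feasible = schedule r
               , (λ e → mk⇔ ∈⇒Belongs Belongs⇒∈)
               , (λ e e∈ → GroupEvent⇒WellFormed (proj₂ (proj₂ (∈schedule⁻ {r} e∈))))
               , schedule-chronological r ℕ.≤-refl
               , proj₁ (schedule-battery r ℕ.≤-refl)
        where
        ∈⇒Belongs : ∀ {e} → e ∈ schedule r → Belongs I R d e
        ∈⇒Belongs e∈ with ∈schedule⁻ e∈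
        ... | h , h≤r , in-h = GroupEvent⇒Belongs h≤r in-h
        Belongs⇒∈ : ∀ {e} → Belongs I R d e → e ∈ schedule r
        Belongs⇒∈ belongs with Belongs⇒GroupEvent belongs
        ... | h , h≤r , in-h = ∈schedule⁺ h≤r in-h

  -- A run of the algorithm

  InGroup? : ∀ j g → Dec (InGroup I j g)
  InGroup? j g = g ℕ.≤? r Dec.×-dec (starts-after? g Dec.×-dec starts-before?)
    where
    starts-after? : ∀ g → Dec (StartsAfter j g)
    starts-after? zero    = yes λ ()
    starts-after? (suc k) = Dec.map′ (λ { tA≤tL refl → tA≤tL }) (λ after → after refl) (tA k ℚ.≤? tL j)
    starts-before? : Dec (g ℕ.< r → tL j < tA g)
    starts-before? with g ℕ.<? r
    ... | yes g<r = Dec.map′ (λ tL<tA _ → tL<tA) (λ before → before g<r) (tL j ℚ.<? tA g)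
    ... | no ¬g<r = yes λ g<r → ⊥-elim (¬g<r g<r)

  IsFirst? : ∀ j k → Dec (IsFirst I j k)
  IsFirst? j k = InGroup? j (suc k) Dec.×-dec (tL j ℚ.≤? tD k Dec.×-dec tD k ℚ.≤? tR j)

  IsLast? : ∀ j g → Dec (IsLast I j g)
  IsLast? j g = g ℕ.<? r Dec.×-dec (InGroup? j g Dec.×-dec (tL j ℚ.≤? tA g Dec.×-dec tA g ℚ.≤? tR j))

  firstOf : ℕ → Maybe (Fin n)
  firstOf k = witness (Fin.any? λ j → IsFirst? j k)

  lastOf : ℕ → Maybe (Fin n)
  lastOf g = witness (Fin.any? λ j → IsLast? j g)

  group : Fin n → ℕ
  group j = proj₁ (group-exists j)

  InGroup-group : ∀ j → InGroup I j (group j)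
  InGroup-group j = proj₂ (group-exists j)

  members : ℕ → List (Fin n)
  members g = filter (λ j → group j ℕ.≟ g) (allFin n)

  open import Data.List.Sort (On.decTotalOrder (Flip.decTotalOrder ℚ.≤-decTotalOrder) cost)
    using () renaming (sort to sortByCost; sort-↭ to sortByCost-↭; sort-↗ to sortByCost-↗)

  order : ℕ → List (Fin n)
  order g = sortByCost (members g)

  ∈order⇔InGroup : ∀ g j → j ∈ order g ⇔ InGroup I j g
  ∈order⇔InGroup g j = mk⇔
    (λ j∈ → subst (InGroup I j)
                  (proj₂ (∈.∈-filter⁻ (λ j → group j ℕ.≟ g) {xs = allFin n} (↭.∈-resp-↭ (sortByCost-↭ _) j∈)))
                  (InGroup-group j))
    (λ in-g → ↭.∈-resp-↭ (↭-sym (sortByCost-↭ _))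
                (∈.∈-filter⁺ (λ j → group j ℕ.≟ g) (∈.∈-allFin j) (InGroup-unique (InGroup-group j) in-g)))

  order-unique : ∀ g → Unique (order g)
  order-unique g = Unique-resp-↭ (↭-sym (sortByCost-↭ _)) (Unique.filter⁺ _ (Unique.allFin⁺ n))

  block : Fin n → ℕ
  block j = firstFitBlock [] (order (group j)) j

  blocks : ℕ → ℕ
  blocks g = length (firstFitLoads [] (order g))

  FFD-order : ∀ g → FFD I [] (order g) block (blocks g)
  FFD-order g = FFD-firstFit block [] (order g) (order-unique g)
    λ {j} j∈ → cong (λ h → firstFitBlock [] (order h) j)
                    (InGroup-unique (InGroup-group j) (Equivalence.to (∈order⇔InGroup g j) j∈))

  M : ℕ
  M = mmax I blocks ℕ.+ 2

  blocks-≤-mmax : ∀ {g} → g ℕ.≤ r → blocks g ℕ.≤ mmax I blocks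
  blocks-≤-mmax g≤r = ∈⇒≤foldr-⊔ (∈.∈-map⁺ blocks (∈.∈-upTo⁺ (s≤s g≤r)))

  -- D^first_{k+1} avoids the m_k ≤ m_max drones of group k and D^last_{k-1}; any other block avoids
  -- D^first, D^last of the previous group and the drones of fewer than m_max earlier blocks.
  room : ∀ {a c} → a ℕ.≤ 1 → c ℕ.≤ mmax I blocks → a ℕ.+ c ℕ.< M
  room {a} {c} a≤1 c≤mmax = subst (a ℕ.+ c ℕ.<_) (ℕ.+-comm 2 (mmax I blocks)) (s≤s (ℕ.+-mono-≤ a≤1 c≤mmax))

  d₀ : Fin M
  d₀ = Fin.fromℕ< (room {0} z≤n z≤n)

  open Fresh d₀

  firstBlock : ℕ → Maybe ℕ
  firstBlock k = Maybe.map block (firstOf k)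

  -- drone g b serves block b of group g, firstDrone k is D^first_{k+1} and lastDrone g lists D^last_g;
  -- group 0 has no first block.
  mutual
    drone : ℕ → ℕ → Fin M
    drone zero    = Assign.assign nothing d₀ []
    drone (suc k) = Assign.assign (firstBlock k) (firstDrone k) (lastDrone k)

    lastDrone : ℕ → List (Fin M)
    lastDrone g = fromMaybe (Maybe.map (drone g ∘ block) (lastOf g))

    firstDrone : ℕ → Fin M
    firstDrone k = pick (lastDroneBefore k ++ map (drone k) (upTo (blocks k)))

    lastDroneBefore : ℕ → List (Fin M)
    lastDroneBefore zero    = []
    lastDroneBefore (suc k) = lastDrone k

  module Group₀ = Assign nothing d₀ []
  module Group₁₊ k = Assign (firstBlock k) (firstDrone k) (lastDrone k)

  length-lastDrone : ∀ g → length (lastDrone g) ℕ.≤ 1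
  length-lastDrone g with lastOf g
  ... | just _  = ℕ.≤-refl
  ... | nothing = z≤n

  length-lastDroneBefore : ∀ k → length (lastDroneBefore k) ℕ.≤ 1
  length-lastDroneBefore zero    = z≤n
  length-lastDroneBefore (suc k) = length-lastDrone k

  lastDrone-∈ : ∀ {j g} → IsLast I j g → drone g (block j) ∈ lastDrone g
  lastDrone-∈ {j} {g} last = subst (λ x → drone g (block j) ∈ fromMaybe (Maybe.map (drone g ∘ block) x))
    (sym (witness-unique IsLast-unique (Fin.any? λ j → IsLast? j g) last)) (here refl)

  firstDrone-∉ : ∀ {k} → k ℕ.≤ r → firstDrone k ∉ lastDroneBefore k ++ map (drone k) (upTo (blocks k))
  firstDrone-∉ {k} k≤r = pick-∉ _ (subst (ℕ._< M) (sym length-avoided)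
                                    (room (length-lastDroneBefore k) (blocks-≤-mmax k≤r)))
    where
    length-avoided : length (lastDroneBefore k ++ map (drone k) (upTo (blocks k)))
                   ≡ length (lastDroneBefore k) ℕ.+ blocks k
    length-avoided = trans (length-++ (lastDroneBefore k))
      (cong (length (lastDroneBefore k) ℕ.+_) (trans (length-map (drone k) (upTo (blocks k)))
                                                      (length-upTo (blocks k))))

  fits : ∀ (avoid : List (Fin M)) {g b} → length avoid ℕ.≤ 1 → g ℕ.≤ r → b ℕ.< blocks g →
         suc (length avoid ℕ.+ b) ℕ.< M
  fits avoid {b = b} |avoid|≤1 g≤r b<blocks = subst (ℕ._< M) (ℕ.+-suc (length avoid) b)
    (room |avoid|≤1 (ℕ.≤-trans b<blocks (blocks-≤-mmax g≤r)))

  drone-first : ∀ {j k} → IsFirst I j k → drone (suc k) (block j) ≡ firstDrone k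
  drone-first {k = k} first = Group₁₊.assign-first k
    (cong (Maybe.map block) (witness-unique IsFirst-unique (Fin.any? λ j → IsFirst? j k) first))

  drone-injective : ∀ g {b b'} → g ℕ.≤ r → b ℕ.< blocks g → b' ℕ.< blocks g →
                    drone g b ≡ drone g b' → b ≡ b'
  drone-injective zero    g≤r b< b'< = Group₀.assign-injective (fits [] z≤n g≤r b<) (fits [] z≤n g≤r b'<)
  drone-injective (suc k) g≤r b< b'< = Group₁₊.assign-injective k
    (fits (lastDrone k) (length-lastDrone k) g≤r b<) (fits (lastDrone k) (length-lastDrone k) g≤r b'<)

  first-avoids-previous : ∀ k j b → IsFirst I j k → b ℕ.< blocks k → drone (suc k) (block j) ≢ drone k b
  first-avoids-previous k j b first@((k<r , _) , _) b< same = firstDrone-∉ (ℕ.<⇒≤ k<r)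
    (∈.∈-++⁺ʳ (lastDroneBefore k) (subst (_∈ map (drone k) (upTo (blocks k)))
                                         (trans (sym same) (drone-first first))
                                         (∈.∈-map⁺ (drone k) (∈.∈-upTo⁺ b<))))

  first-avoids-last : ∀ k k' j j' → k ≡ suc k' → IsFirst I j k → IsLast I j' k' →
                      drone (suc k) (block j) ≢ drone k' (block j')
  first-avoids-last k k' j j' refl first@((k<r , _) , _) last same = firstDrone-∉ (ℕ.<⇒≤ k<r)
    (∈.∈-++⁺ˡ (subst (_∈ lastDrone k') (trans (sym same) (drone-first first)) (lastDrone-∈ last)))

  others-avoid-last : ∀ k b j' → b ℕ.< blocks (suc k) → (∀ j → IsFirst I j k → b ≢ block j) →
                      IsLast I j' k → drone (suc k) b ≢ drone k (block j')
  others-avoid-last k b j' b< not-first last@(k<r , _) same = Group₁₊.assign-avoids k not-first-block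
    (fits (lastDrone k) (length-lastDrone k) k<r b<) (subst (_∈ lastDrone k) (sym same) (lastDrone-∈ last))
    where
    not-first-block : firstBlock k ≢ just b
    not-first-block with firstOf k in first-is
    ... | just j  = λ same-block → not-first j (witness-sound (Fin.any? λ j → IsFirst? j k) first-is)
                                     (sym (just-injective same-block))
    ... | nothing = λ ()

  Used : ℕ → Fin M → Set
  Used g d = Σ ℕ λ g' → Σ ℕ λ b → g' ℕ.≤ g × b ℕ.< blocks g' × drone g' b ≡ d

  used? : ∀ g d → Dec (Used g d)
  used? g d = Dec.map′ (λ (g' , g'<1+g , b , b< , same) → g' , b , ℕ.≤-pred g'<1+g , b< , same)
                       (λ (g' , b , g'≤g , b< , same) → g' , s≤s g'≤g , b , b< , same)
                       (ℕ.anyUpTo? (λ g' → ℕ.anyUpTo? (λ b → drone g' b Fin.≟ d) (blocks g')) (suc g))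

  IsLastDrone : ℕ → Fin M → Set
  IsLastDrone g d = Σ (Fin n) λ j → IsLast I j g × drone g (block j) ≡ d

  ChargeRule : ℕ → Fin M → ℚ → Set
  ChargeRule g d lvl = g ℕ.< r × Used g d × lvl < B × ¬ IsLastDrone g d

  chargeRule? : ∀ g d lvl → Dec (ChargeRule g d lvl)
  chargeRule? g d lvl = g ℕ.<? r Dec.×-dec (used? g d Dec.×-dec (lvl ℚ.<? B Dec.×-dec Dec.¬?
                          (Fin.any? λ j → IsLast? j g Dec.×-dec drone g (block j) Fin.≟ d)))

  servedCost : ℕ → Fin M → ℚ
  servedCost g d = totalCost (filter (λ j → drone g (block j) Fin.≟ d) (order g))

  -- battery of the run under construction: charges needs it before the run exists
  mutual
    level : ℕ → Fin M → ℚ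
    level zero    d = B - servedCost zero d
    level (suc g) d = (if charges g d then Ch g (tA g) (tD g) (level g d) else level g d) - servedCost (suc g) d

    charges : ℕ → Fin M → Bool
    charges g d = does (chargeRule? g d (level g d))

  battery≡level : ∀ g d → battery I order block blocks drone charges g d ≡ level g d
  battery≡level zero    d = refl
  battery≡level (suc g) d = cong (λ x → (if charges g d then Ch g (tA g) (tD g) x else x) - servedCost (suc g) d)
                                 (battery≡level g d)

  charges⇔ : ∀ g d → T (charges g d) ⇔ ChargeRule g d (battery I order block blocks drone charges g d)
  charges⇔ g d rewrite battery≡level g d = T-does⇔ (chargeRule? g d (level g d))

  run : Run I
  run = record
    { ord        = order
    ; blk        = block
    ; m          = blocks
    ; dr         = drone
    ; chg        = charges
    ; ord-group  = λ g _ j → ∈order⇔InGroup g j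
    ; ord-unique = λ g _ → order-unique g
    ; ord-sorted = λ g _ → sortByCost-↗ (members g)
    ; ffd        = λ g _ → FFD-order g
    ; distinct   = λ g b b' g≤r → drone-injective g g≤r
    ; first-prev = first-avoids-previous
    ; first-last = first-avoids-last
    ; other-last = others-avoid-last
    ; charging   = charges⇔
    }

lemma3 : (I : Instance) → Valid I →
         Run I
         × ((R : Run I) →
              ((j : Fin (Instance.n I)) →
                 Σ (Drone I R) λ d → Serves I R d j
                   × ((d' : Drone I R) → Serves I R d' j → d' ≡ d))
              × ((d : Drone I R) → DroneFeasible I R d))
lemma3 I V = run I V , λ R → Feasibility.served-by-unique-drone I V R , λ d → Feasibility.ForDrone.feasible I V R d
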